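{- Let $a, b, c, d, t, u, v$ be non-negative integers such that $2 \le v \le u-1$ and $0 \le t \le u-1$. Suppose there exists a $(v+1)$-RGDD of type $u^{v+1}$. Suppose also that there exist 4-GDDs of types $a^u d^1$ and $b^u d^1$, as well as a 4-GDD of type $a^v b^1 c^1$ if $tc > 0$, and a 4-GDD of type $a^v b^1$ if $c = 0$ or $t < u-1$. Then there exists a 4-GDD of type $(va+b)^u (ct+d)^1$.
   Context: For an integer $k\ge 2$, a $k$-GDD of type $g_1^{u_1}\cdots g_r^{u_r}$ is a triple $(V,\mathcal{G},\mathcal{B})$ where $V$ is a finite set of $u_1g_1+\dots+u_rg_r$ points, $\mathcal{G}$ is a partition of $V$ into groups, exactly $u_i$ of which have size $g_i$, and $\mathcal{B}$ is a non-empty collection of $k$-element subsets of $V$ (blocks) such that every pair of points from distinct groups lies in exactly one block and no pair of points from the same group lies in a block. A 4-GDD is a $k$-GDD with $k=4$. A parallel class is a set of blocks in which every point of $V$ appears exactly once; a $k$-RGDD is a $k$-GDD whose block set can be partitioned into parallel classes. In type notation a group of size $0$ is understood to be absent (e.g. type $a^u 0^1$ means $a^u$). -}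

module Defs where

open import Data.Nat using (ℕ; _≤_)
open import Data.Fin using (Fin)
open import Data.List using (List; length; lookup)
open import Data.Product using (Σ; _×_)
open import Relation.Binary.PropositionalEquality using (_≡_; _≢_)
open import Function.Bundles using (_↔_)
open import Function.Definitions using (Injective)

-- A k-GDD whose type is given by a list L of group sizes (one entry per
-- group).  Entries equal to 0 give empty groups, which impose
-- no condition, matching the convention that a group of size 0 is absent.
record GDD (k : ℕ) (L : List ℕ) : Set where
  field
    n        : ℕ
    grp      : Fin n → Fin (length L)
    grpSize  : (i : Fin (length L)) → Σ (Fin n) (λ x → grp x ≡ i) ↔ Fin (lookup L i)
    nb       : ℕ
    nonEmpty : 1 ≤ nb
    blk      : Fin nb → Fin k → Fin n
    blkInj   : (j : Fin nb) → Injective _≡_ _≡_ (blk j)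

  _∈B_ : Fin n → Fin nb → Set
  x ∈B j = Σ (Fin k) (λ i → blk j i ≡ x)

  field
    cover    : (x y : Fin n) → grp x ≢ grp y →
               Σ (Fin nb) (λ j → (x ∈B j × y ∈B j) ×
                 ((j' : Fin nb) → x ∈B j' → y ∈B j' → j' ≡ j))
    noSame   : (j : Fin nb) (i i' : Fin k) → i ≢ i' → grp (blk j i) ≢ grp (blk j i')

record RGDD (k : ℕ) (L : List ℕ) : Set where
  field
    gdd : GDD k L
  open GDD gdd
  field
    r        : ℕ
    cls      : Fin nb → Fin r
    parallel : (c : Fin r) (x : Fin n) →
               Σ (Fin nb) (λ j → (cls j ≡ c × x ∈B j) ×
                 ((j' : Fin nb) → cls j' ≡ c → x ∈B j' → j' ≡ j))

-- The RGDD is a resolvable transversal design TD(v+1, u): each block meets each group in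
-- one point, and there are u parallel classes. Inflate the points of v of its groups by a
-- and those of the last group by b, and add c·t + d points at infinity. The blocks of one
-- parallel class P₀ become the u new groups, of size va + b; the points at infinity form the
-- last group. On every block of the i-th of t further classes place a 4-GDD of type
-- a^v b^1 c^1 whose group of size c is the i-th slice of c·t points at infinity, and on
-- every block of the remaining classes other than P₀ one of type a^v b^1. Finally, on each
-- inflated group of the TD together with the d remaining points at infinity place a 4-GDD
-- of type a^u d^1 or b^u d^1, whose u groups are the P₀-blocks. Two points in different new
-- groups then lie in exactly one of these designs: that of their common TD group, or of the
-- block through them, or, for a point of the i-th slice, of the i-th-class block through
-- the other point.

module Submission where

open import Defs
open import Data.Nat using (ℕ; zero; suc; _+_; _*_; _∸_; _≤_; _<_; s≤s; z≤n; >-nonZero⁻¹; ≢-nonZero⁻¹)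
open import Data.Nat.Properties using (n<1+n; m∸n≢0⇒n<m; m+[n∸m]≡n)
open import Data.Fin using (Fin; zero; suc; punchOut; fromℕ<)
open import Data.Fin.Properties
  using (_≟_; nonZeroIndex; any?; pigeonhole; punchOut-injective; <⇒≢; +↔⊎; *↔×; 1↔⊤)
open import Data.List using (List; length; lookup; replicate; _++_; _∷_; [])
open import Data.List.Properties using (++-assoc; length-replicate)
open import Data.Product using (Σ; _×_; _,_; proj₁; proj₂)
import Data.Product
open import Data.Product.Function.Dependent.Propositional using (Σ-↔)
open import Data.Sum using (_⊎_; inj₁; inj₂; [_,_])
import Data.Sum
open import Data.Sum.Algebra using (⊎-cong)
open import Data.Sum.Properties using (inj₁-injective; inj₂-injective; ≡-dec)
import Data.Unit.Properties
open import Data.Unit using (⊤; tt)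
open import Data.Empty using (⊥-elim)
open import Function using (_∘_; const; id)
open import Function.Bundles using (_↔_; Inverse; mk↔ₛ′)
open import Function.Definitions using (Injective)
open import Function.Properties.Inverse using (↔-refl; ↔-sym; ↔-trans; ↔⇒↣)
open import Function.Related.TypeIsomorphisms using (Σ-distribʳ-⊎)
open import Relation.Binary.PropositionalEquality using (_≡_; _≢_; refl; sym; trans; cong; subst; module ≡-Reasoning)
open import Relation.Nullary using (yes; no)
open import Axiom.UniquenessOfIdentityProofs.WithK using (uip)

open Inverse using (to; from; strictlyInverseˡ; strictlyInverseʳ)

to-injective : {A B : Set} (β : A ↔ B) → Injective _≡_ _≡_ (to β)
to-injective β = Function.Bundles.Injection.injective (↔⇒↣ β)

from-injective : {A B : Set} (β : A ↔ B) → Injective _≡_ _≡_ (from β)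
from-injective β = to-injective (↔-sym β)

Finite : Set → Set
Finite A = Σ ℕ λ n → A ↔ Fin n

≡⇒Fin↔ : ∀ {m n} → m ≡ n → Fin m ↔ Fin n
≡⇒Fin↔ refl = ↔-refl

Σ-Fin-suc-↔ : ∀ {m} (F : Fin (suc m) → Set) → Σ (Fin (suc m)) F ↔ (F zero ⊎ Σ (Fin m) (F ∘ suc))
Σ-Fin-suc-↔ {m} F = mk↔ₛ′ split join split-join join-split
  where
  split : Σ (Fin (suc m)) F → F zero ⊎ Σ (Fin m) (F ∘ suc)
  split (zero , x)  = inj₁ x
  split (suc i , x) = inj₂ (i , x)
  join : F zero ⊎ Σ (Fin m) (F ∘ suc) → Σ (Fin (suc m)) F
  join (inj₁ x)       = zero , x
  join (inj₂ (i , x)) = suc i , x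
  split-join : ∀ y → split (join y) ≡ y
  split-join (inj₁ _) = refl
  split-join (inj₂ _) = refl
  join-split : ∀ x → join (split x) ≡ x
  join-split (zero , _) = refl
  join-split (suc _ , _) = refl

Σ-Fin-finite : ∀ m {F : Fin m → Set} → (∀ i → Finite (F i)) → Finite (Σ (Fin m) F)
Σ-Fin-finite zero fin = 0 , mk↔ₛ′ (λ { (() , _) }) (λ ()) (λ ()) (λ { (() , _) })
Σ-Fin-finite (suc m) {F} fin
  with n₀ , F₀↔ ← fin zero | n , rest↔ ← Σ-Fin-finite m (fin ∘ suc)
  = n₀ + n , ↔-trans (Σ-Fin-suc-↔ F) (↔-trans (⊎-cong F₀↔ rest↔) (↔-sym +↔⊎))

Σ-finite : ∀ {I} {F : I → Set} → Finite I → (∀ i → Finite (F i)) → Finite (Σ I F)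
Σ-finite (m , I↔) fin
  with n , Σ↔ ← Σ-Fin-finite m (fin ∘ from I↔)
  = n , ↔-trans (↔-sym (Σ-↔ (↔-sym I↔) ↔-refl)) Σ↔

⊎-finite : ∀ {A B} → Finite A → Finite B → Finite (A ⊎ B)
⊎-finite (m , A↔) (n , B↔) = m + n , ↔-trans (⊎-cong A↔ B↔) (↔-sym +↔⊎)

Fibre : {X G : Set} → (X → G) → G → Set
Fibre {X} γ g = Σ X λ x → γ x ≡ g

fibres-↔ : {X G : Set} (γ : X → G) → X ↔ Σ G (Fibre γ)
fibres-↔ γ = mk↔ₛ′ (λ x → γ x , x , refl) (λ (_ , x , _) → x)
  (λ { (_ , _ , refl) → refl }) (λ _ → refl)

from≡↔≡to : {A B : Set} (β : A ↔ B) {a : A} {b : B} → (from β b ≡ a) ↔ (b ≡ to β a)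
from≡↔≡to β {a} {b} = mk↔ₛ′
  (λ e → trans (sym (strictlyInverseˡ β b)) (cong (to β) e))
  (λ e → trans (cong (from β) e) (strictlyInverseʳ β a))
  (λ _ → uip _ _) (λ _ → uip _ _)

Fin+1↔⊎⊤ : ∀ n → Fin (n + 1) ↔ (Fin n ⊎ ⊤)
Fin+1↔⊎⊤ n = ↔-trans +↔⊎ (⊎-cong ↔-refl 1↔⊤)

-- A missed y could be punched out, giving an injection Fin (suc n) → Fin n.
Fin-injective⇒surjective : ∀ {n} (f : Fin n → Fin n) → Injective _≡_ _≡_ f →
                           ∀ y → Σ (Fin n) λ x → f x ≡ y
Fin-injective⇒surjective {suc n} f f-inj y with any? (λ x → f x ≟ y)
... | yes hit = hit
... | no miss
  with x , x′ , x<x′ , e ← pigeonhole (n<1+n n) (λ x → punchOut {i = y} {j = f x} (miss ∘ (x ,_) ∘ sym))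
  = ⊥-elim (<⇒≢ x<x′ (f-inj (punchOut-injective (miss ∘ (x ,_) ∘ sym) (miss ∘ (x′ ,_) ∘ sym) e)))

-- The GDD of Defs over arbitrary types of points, groups and blocks; in a Design the points
-- of group g are Fin (size g).
record GroupDesign (k : ℕ) {P G : Set} (γ : P → G) : Set₁ where
  field
    Block  : Set
    blk    : Block → Fin k → P
    blkInj : ∀ j → Injective _≡_ _≡_ (blk j)

  _∈B_ : P → Block → Set
  x ∈B j = Σ (Fin k) λ a → blk j a ≡ x

  field
    cover  : ∀ x y → γ x ≢ γ y →
             Σ Block λ j → (x ∈B j × y ∈B j) × (∀ j′ → x ∈B j′ → y ∈B j′ → j′ ≡ j)
    noSame : ∀ j a a′ → a ≢ a′ → γ (blk j a) ≢ γ (blk j a′)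

record Resolution {k : ℕ} {P G : Set} {γ : P → G} (D : GroupDesign k γ) : Set where
  open GroupDesign D
  field
    r        : ℕ
    cls      : Block → Fin r
    parallel : ∀ κ x → Σ Block λ j → (cls j ≡ κ × x ∈B j) ×
                 (∀ j′ → cls j′ ≡ κ → x ∈B j′ → j′ ≡ j)

Design : ℕ → {G : Set} → (G → ℕ) → Set₁
Design k {G} size = GroupDesign k (proj₁ {A = G} {B = Fin ∘ size})

gddDesign : ∀ {k L} (H : GDD k L) → GroupDesign k (GDD.grp H)
gddDesign H = record { Block = Fin nb ; GDD H }
  where open GDD H using (nb)

module Transport {k : ℕ} {P Q G H : Set} {γ : P → G} {δ : Q → H}
  (D : GroupDesign k γ) (θ : P ↔ Q) {β : G → H} (β-injective : Injective _≡_ _≡_ β)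
  (compatible : ∀ x → δ (to θ x) ≡ β (γ x)) where

  open GroupDesign D

  _∈′_ : Q → Block → Set
  y ∈′ j = Σ (Fin k) λ a → to θ (blk j a) ≡ y

  ∈′⇒∈ : ∀ {y j} → y ∈′ j → from θ y ∈B j
  ∈′⇒∈ (a , e) = a , trans (sym (strictlyInverseʳ θ _)) (cong (from θ) e)

  ∈⇒∈′ : ∀ {y j} → from θ y ∈B j → y ∈′ j
  ∈⇒∈′ {y} (a , e) = a , trans (cong (to θ) e) (strictlyInverseˡ θ y)

  γ-from : ∀ y → β (γ (from θ y)) ≡ δ y
  γ-from y = trans (sym (compatible _)) (cong δ (strictlyInverseˡ θ y))

  transported : GroupDesign k δ
  transported = record
    { Block  = Block
    ; blk    = λ j → to θ ∘ blk j
    ; blkInj = λ j → blkInj j ∘ to-injective θ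
    ; cover  = λ x y δx≢δy →
        let j , (x∈ , y∈) , unique = cover (from θ x) (from θ y)
              (λ γ≡ → δx≢δy (trans (sym (γ-from x)) (trans (cong β γ≡) (γ-from y))))
        in  j , (∈⇒∈′ x∈ , ∈⇒∈′ y∈)
          , λ j′ x∈′ y∈′ → unique j′ (∈′⇒∈ x∈′) (∈′⇒∈ y∈′)
    ; noSame = λ j a a′ a≢a′ δ≡ → noSame j a a′ a≢a′
                 (β-injective (trans (sym (compatible _)) (trans δ≡ (compatible _))))
    }

  transportedResolution : Resolution D → Resolution transported
  transportedResolution R = record
    { r        = r
    ; cls      = cls
    ; parallel = λ κ y →
        let j , (clsj , y∈) , unique = parallel κ (from θ y)
        in  j , (clsj , ∈⇒∈′ y∈) , λ j′ clsj′ y∈′ → unique j′ clsj′ (∈′⇒∈ y∈′)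
    }
    where open Resolution R

reindexBlocks : ∀ {k} {P G : Set} {γ : P → G} (D : GroupDesign k γ) {B′ : Set} →
                GroupDesign.Block D ↔ B′ → GroupDesign k γ
reindexBlocks D {B′} B↔ = record
  { Block  = B′
  ; blk    = blk ∘ from B↔
  ; blkInj = blkInj ∘ from B↔
  ; cover  = λ x y γx≢γy →
      let j , ((a , xa) , (b , yb)) , unique = cover x y γx≢γy
      in  to B↔ j
        , ((a , trans (cong (λ j → blk j a) (strictlyInverseʳ B↔ j)) xa)
        ,  (b , trans (cong (λ j → blk j b) (strictlyInverseʳ B↔ j)) yb))
        , λ j′ x∈ y∈ → trans (sym (strictlyInverseˡ B↔ j′))
                             (cong (to B↔) (unique (from B↔ j′) x∈ y∈))
  ; noSame = noSame ∘ from B↔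
  }
  where open GroupDesign D

module Glue {k : ℕ} {X G : Set} (γ : X → G) {I : Set} {Pt Gl : I → Set}
  (lγ : ∀ i → Pt i → Gl i) (D : ∀ i → GroupDesign k (lγ i))
  (embed : ∀ i → Pt i → X) (embed-injective : ∀ i → Injective _≡_ _≡_ (embed i))
  (embed-separates : ∀ i x y → lγ i x ≢ lγ i y → γ (embed i x) ≢ γ (embed i y)) where

  record Covering (x y : X) : Set where
    constructor covering
    field
      index  : I
      x′ y′  : Pt index
      x′↦x   : embed index x′ ≡ x
      y′↦y   : embed index y′ ≡ y
      apart  : lγ index x′ ≢ lγ index y′
      unique : ∀ i x″ y″ → embed i x″ ≡ x → embed i y″ ≡ y → i ≡ index

  Covering-sym : ∀ {x y} → Covering x y → Covering y x
  Covering-sym (covering i x′ y′ x′↦x y′↦y apart unique) =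
    covering i y′ x′ y′↦y x′↦x (apart ∘ sym) λ i′ y″ x″ y↦ x↦ → unique i′ x″ y″ x↦ y↦

  Block : Set
  Block = Σ I (GroupDesign.Block ∘ D)

  blk : Block → Fin k → X
  blk (i , j) = embed i ∘ GroupDesign.blk (D i) j

  _∈_ : X → Block → Set
  x ∈ J = Σ (Fin k) λ a → blk J a ≡ x

  module _ (covered : ∀ x y → γ x ≢ γ y → Covering x y) where

    unique-block : ∀ {x y} (C : Covering x y) → let open Covering C in
      (j : GroupDesign.Block (D index)) →
      (∀ j′ → GroupDesign._∈B_ (D index) x′ j′ → GroupDesign._∈B_ (D index) y′ j′ → j′ ≡ j) →
      ∀ J → x ∈ J → y ∈ J → J ≡ (index , j)
    unique-block (covering i x′ y′ x′↦x y′↦y _ unique) j local-unique (i′ , j′) (a , xa) (b , yb)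
      with unique i′ _ _ xa yb
    ... | refl = cong (i ,_) (local-unique j′
                   (a , embed-injective i (trans xa (sym x′↦x)))
                   (b , embed-injective i (trans yb (sym y′↦y))))

    glued : GroupDesign k γ
    glued = record
      { Block  = Block
      ; blk    = blk
      ; blkInj = λ (i , j) → GroupDesign.blkInj (D i) j ∘ embed-injective i
      ; cover  = λ x y γx≢γy →
          let C@(covering i x′ y′ x′↦x y′↦y apart _) = covered x y γx≢γy
              j , ((a , x′a) , (b , y′b)) , local-unique = GroupDesign.cover (D i) x′ y′ apart
          in  (i , j)
            , ((a , trans (cong (embed i) x′a) x′↦x) , (b , trans (cong (embed i) y′b) y′↦y))
            , unique-block C j local-unique
      ; noSame = λ (i , j) a a′ a≢a′ → embed-separates i _ _ (GroupDesign.noSame (D i) j a a′ a≢a′)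
      }

record Labelling (L : List ℕ) {G : Set} (size : G → ℕ) : Set where
  field
    index        : Fin (length L) ↔ G
    lookup-index : ∀ i → lookup L i ≡ size (to index i)

relabel : ∀ {L} {G G′ : Set} {size : G → ℕ} {size′ : G′ → ℕ} → Labelling L size →
          (β : G ↔ G′) → (∀ g → size′ (to β g) ≡ size g) → Labelling L size′
relabel ℓ β size-β = record
  { index        = ↔-trans index β
  ; lookup-index = λ i → trans (lookup-index i) (sym (size-β _))
  }
  where open Labelling ℓ

replicate-labelling : ∀ m s → Labelling (replicate m s) {Fin m} (const s)
replicate-labelling m s = record { index = ≡⇒Fin↔ (length-replicate m) ; lookup-index = lookup-replicate m }
  where
  lookup-replicate : ∀ m i → lookup (replicate m s) i ≡ s
  lookup-replicate (suc m) zero    = refl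
  lookup-replicate (suc m) (suc i) = lookup-replicate m i

module _ {y : ℕ} where

  split-∷ʳ : ∀ xs → Fin (length (xs ++ y ∷ [])) → Fin (length xs) ⊎ ⊤
  split-∷ʳ []       zero    = inj₂ tt
  split-∷ʳ (_ ∷ _)  zero    = inj₁ zero
  split-∷ʳ (_ ∷ xs) (suc i) = Data.Sum.map suc id (split-∷ʳ xs i)

  join-∷ʳ : ∀ xs → Fin (length xs) ⊎ ⊤ → Fin (length (xs ++ y ∷ []))
  join-∷ʳ []       (inj₂ tt)      = zero
  join-∷ʳ (_ ∷ _)  (inj₁ zero)    = zero
  join-∷ʳ (_ ∷ xs) (inj₁ (suc i)) = suc (join-∷ʳ xs (inj₁ i))
  join-∷ʳ (_ ∷ xs) (inj₂ tt)      = suc (join-∷ʳ xs (inj₂ tt))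

  split-join-∷ʳ : ∀ xs i → split-∷ʳ xs (join-∷ʳ xs i) ≡ i
  split-join-∷ʳ []       (inj₂ tt)      = refl
  split-join-∷ʳ (_ ∷ _)  (inj₁ zero)    = refl
  split-join-∷ʳ (_ ∷ xs) (inj₁ (suc i)) = cong (Data.Sum.map suc id) (split-join-∷ʳ xs (inj₁ i))
  split-join-∷ʳ (_ ∷ xs) (inj₂ tt)      = cong (Data.Sum.map suc id) (split-join-∷ʳ xs (inj₂ tt))

  join-split-∷ʳ : ∀ xs i → join-∷ʳ xs (split-∷ʳ xs i) ≡ i
  join-split-∷ʳ []       zero    = refl
  join-split-∷ʳ (_ ∷ _)  zero    = refl
  join-split-∷ʳ (_ ∷ xs) (suc i) with split-∷ʳ xs i | join-split-∷ʳ xs i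
  ... | inj₁ _  | e = cong suc e
  ... | inj₂ tt | e = cong suc e

  lookup-split-∷ʳ : ∀ xs i → lookup (xs ++ y ∷ []) i ≡ [ lookup xs , const y ] (split-∷ʳ xs i)
  lookup-split-∷ʳ []       zero    = refl
  lookup-split-∷ʳ (_ ∷ _)  zero    = refl
  lookup-split-∷ʳ (_ ∷ xs) (suc i) with split-∷ʳ xs i | lookup-split-∷ʳ xs i
  ... | inj₁ _  | e = e
  ... | inj₂ tt | e = e

∷ʳ-labelling : ∀ {xs y} {G : Set} {size : G → ℕ} →
               Labelling xs size → Labelling (xs ++ y ∷ []) [ size , const y ]
∷ʳ-labelling {xs} {y} {size = size} ℓ = record
  { index        = ↔-trans (mk↔ₛ′ (split-∷ʳ xs) (join-∷ʳ xs) (split-join-∷ʳ xs) (join-split-∷ʳ xs))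
                           (⊎-cong index ↔-refl)
  ; lookup-index = λ i → trans (lookup-split-∷ʳ xs i) (lookup-index′ (split-∷ʳ xs i))
  }
  where
  open Labelling ℓ
  lookup-index′ : ∀ i → [ lookup xs , const y ] i ≡ [ size , const y ] (Data.Sum.map (to index) id i)
  lookup-index′ (inj₁ i)  = lookup-index i
  lookup-index′ (inj₂ tt) = refl

module Labelled {k : ℕ} {L : List ℕ} {G : Set} {size : G → ℕ} (H : GDD k L) (ℓ : Labelling L size) where
  open GDD H using (n; grp; grpSize)
  open Labelling ℓ

  points↔ : Fin n ↔ Σ G (Fin ∘ size)
  points↔ = ↔-trans (fibres-↔ grp)
            (↔-trans (Σ-↔ ↔-refl (grpSize _)) (Σ-↔ index (≡⇒Fin↔ (lookup-index _))))

  open Transport {δ = proj₁} (gddDesign H) points↔ (to-injective index) (λ _ → refl) public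
    using (transportedResolution) renaming (transported to design)

withEmptyGroup : ∀ {k} {G : Set} {size : G → ℕ} → Design k size → Design k [ size , const 0 ]
withEmptyGroup {G = G} {size} D = Transport.transported {δ = proj₁} D points↔ inj₁-injective (λ _ → refl)
  where
  points↔ : Σ G (Fin ∘ size) ↔ Σ (G ⊎ ⊤) (Fin ∘ [ size , const 0 ])
  points↔ = mk↔ₛ′ (λ x → inj₁ (proj₁ x) , proj₂ x) (λ { (inj₁ g , w) → g , w ; (inj₂ tt , ()) })
                  (λ { (inj₁ g , w) → refl ; (inj₂ tt , ()) }) (λ _ → refl)

design⇒GDD : ∀ {k L} {X G : Set} {γ : X → G} {size : G → ℕ} (D : GroupDesign k γ) →
             Labelling L size → (∀ g → Fibre γ g ↔ Fin (size g)) →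
             Finite (GroupDesign.Block D) → GroupDesign.Block D → GDD k L
design⇒GDD {k} {L} {X} {γ = γ} {size} D ℓ fibre↔ (nb , B↔) j = record
  { n        = n
  ; grp      = grp
  ; grpSize  = λ i → ↔-trans (Σ-↔ (↔-sym θ) ↔-refl)
                     (↔-trans (Σ-↔ ↔-refl (from≡↔≡to index))
                     (↔-trans (fibre↔ (to index i)) (≡⇒Fin↔ (sym (lookup-index i)))))
  ; nb       = nb
  ; nonEmpty = >-nonZero⁻¹ nb {{nonZeroIndex (to B↔ j)}}
  ; GroupDesign (reindexBlocks (Transport.transported {δ = grp} D θ (from-injective index) grp-to) B↔)
  }
  where
  open Labelling ℓ
  X-finite : Finite X
  X-finite with n , Σ↔ ← Σ-finite (length L , ↔-sym index) (λ g → size g , fibre↔ g)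
    = n , ↔-trans (fibres-↔ γ) Σ↔
  n : ℕ
  n = proj₁ X-finite
  θ : X ↔ Fin n
  θ = proj₂ X-finite
  grp : Fin n → Fin (length L)
  grp = from index ∘ γ ∘ from θ
  grp-to : ∀ x → grp (to θ x) ≡ from index (γ x)
  grp-to = cong (from index ∘ γ) ∘ strictlyInverseʳ θ

module ResolvableTD {k u : ℕ} {G : Set} (G↔Fin : G ↔ Fin k)
  (T : GroupDesign k (proj₁ {A = G} {B = λ _ → Fin u})) (R : Resolution T) where

  open GroupDesign T
  open Resolution R

  Point : Set
  Point = G × Fin u

  group-injective : ∀ j → Injective _≡_ _≡_ (proj₁ ∘ blk j)
  group-injective j {a} {a′} e with a ≟ a′
  ... | yes a≡a′ = a≡a′
  ... | no a≢a′  = ⊥-elim (noSame j a a′ a≢a′ e)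

  -- Opaque here and below: unfolding these definitions makes type checking of the
  -- construction prohibitively slow.
  opaque
    meets : ∀ j g → Σ (Fin k) λ a → proj₁ (blk j a) ≡ g
    meets j g = Data.Product.map₂ (to-injective G↔Fin)
      (Fin-injective⇒surjective (to G↔Fin ∘ proj₁ ∘ blk j)
        (group-injective j ∘ to-injective G↔Fin) (to G↔Fin g))

    pos : Block → G → Fin u
    pos j g = proj₂ (blk j (proj₁ (meets j g)))

    pos-∈ : ∀ j g → (g , pos j g) ∈B j
    pos-∈ j g = proj₁ (meets j g) , cong (_, pos j g) (proj₂ (meets j g))

    ∈⇒pos : ∀ {j g m} → (g , m) ∈B j → m ≡ pos j g
    ∈⇒pos {j} {g} (a′ , e′) with a′ ≟ proj₁ (meets j g)
    ... | yes a′≡a = trans (cong proj₂ (sym e′)) (cong (proj₂ ∘ blk j) a′≡a)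
    ... | no a′≢a  = ⊥-elim (noSame j a′ _ a′≢a (trans (cong proj₁ e′) (sym (proj₂ (meets j g)))))

  classBlock : Fin r → Point → Block
  classBlock κ p = proj₁ (parallel κ p)

  classBlock-cls : ∀ κ p → cls (classBlock κ p) ≡ κ
  classBlock-cls κ p = proj₁ (proj₁ (proj₂ (parallel κ p)))

  classBlock-∈ : ∀ κ p → p ∈B classBlock κ p
  classBlock-∈ κ p = proj₂ (proj₁ (proj₂ (parallel κ p)))

  classBlock-unique : ∀ {κ p j} → cls j ≡ κ → p ∈B j → j ≡ classBlock κ p
  classBlock-unique {κ} {p} {j} = proj₂ (proj₂ (parallel κ p)) j

  module _ {p q : Point} (apart : proj₁ p ≢ proj₁ q) where

    opaque
      line : Block
      line = proj₁ (cover p q apart)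

      line-∈ˡ : p ∈B line
      line-∈ˡ = proj₁ (proj₁ (proj₂ (cover p q apart)))

      line-∈ʳ : q ∈B line
      line-∈ʳ = proj₂ (proj₁ (proj₂ (cover p q apart)))

      line-unique : ∀ {j} → p ∈B j → q ∈B j → j ≡ line
      line-unique {j} = proj₂ (proj₂ (cover p q apart)) j

  module _ (g₀ : G) where

    blockIndex : Fin r → Point → Fin u
    blockIndex κ p = pos (classBlock κ p) g₀

    indexedBlock : Fin r → Fin u → Block
    indexedBlock κ m = classBlock κ (g₀ , m)

    classBlock≡indexedBlock : ∀ κ p → classBlock κ p ≡ indexedBlock κ (blockIndex κ p)
    classBlock≡indexedBlock κ p = classBlock-unique (classBlock-cls κ p) (pos-∈ _ g₀)

    blockIndex-≡⇒classBlock-≡ : ∀ {κ p q} → blockIndex κ p ≡ blockIndex κ q →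
                                classBlock κ p ≡ classBlock κ q
    blockIndex-≡⇒classBlock-≡ {κ} {p} {q} e =
      trans (classBlock≡indexedBlock κ p) (trans (cong (indexedBlock κ) e) (sym (classBlock≡indexedBlock κ q)))

    ∈-class⇒blockIndex-≡ : ∀ {κ j p q} → cls j ≡ κ → p ∈B j → q ∈B j →
                           blockIndex κ p ≡ blockIndex κ q
    ∈-class⇒blockIndex-≡ clsj p∈ q∈ =
      cong (λ J → pos J g₀) (trans (sym (classBlock-unique clsj p∈)) (classBlock-unique clsj q∈))

    blockIndex-separates : ∀ {κ j p q} → cls j ≢ κ → p ∈B j → q ∈B j → proj₁ p ≢ proj₁ q →
                           blockIndex κ p ≢ blockIndex κ q
    blockIndex-separates {κ} {j} {p} {q} clsj≢κ p∈ q∈ apart e = clsj≢κ (begin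
      cls j               ≡⟨ cong cls (line-unique apart p∈ q∈) ⟩
      cls (line apart)    ≡⟨ cong cls (line-unique apart (classBlock-∈ κ p) q∈classBlock) ⟨
      cls (classBlock κ p) ≡⟨ classBlock-cls κ p ⟩
      κ                   ∎)
      where
      open ≡-Reasoning
      q∈classBlock : q ∈B classBlock κ p
      q∈classBlock = subst (q ∈B_) (sym (blockIndex-≡⇒classBlock-≡ e)) (classBlock-∈ κ q)

    blockIndex-injective-on-group : ∀ {κ g m m′} → blockIndex κ (g , m) ≡ blockIndex κ (g , m′) → m ≡ m′
    blockIndex-injective-on-group {κ} {g} {m} {m′} e =
      trans (∈⇒pos (classBlock-∈ κ (g , m)))
            (sym (∈⇒pos (subst ((g , m′) ∈B_) (sym (blockIndex-≡⇒classBlock-≡ e))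
                                (classBlock-∈ κ (g , m′)))))

    blockIndex-pos : ∀ κ m g → blockIndex κ (g , pos (indexedBlock κ m) g) ≡ m
    blockIndex-pos κ m g = trans
      (cong (λ J → pos J g₀) (sym (classBlock-unique (classBlock-cls κ (g₀ , m)) (pos-∈ _ g))))
      (sym (∈⇒pos (classBlock-∈ κ (g₀ , m))))

    blockIndex-≡⇒pos : ∀ {κ m g m′} → blockIndex κ (g , m′) ≡ m → m′ ≡ pos (indexedBlock κ m) g
    blockIndex-≡⇒pos {κ} {m} {g} {m′} e = ∈⇒pos (subst ((g , m′) ∈B_)
      (trans (classBlock≡indexedBlock κ (g , m′)) (cong (indexedBlock κ) e)) (classBlock-∈ κ (g , m′)))

    -- A class corresponds to its block through (g₁, m₁), and that block to its point in g₀.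
    classes↔ : ∀ {g₁} → g₁ ≢ g₀ → Fin u → Fin r ↔ Fin u
    classes↔ {g₁} g₁≢g₀ m₁ = mk↔ₛ′
      (λ κ → blockIndex κ p₁)
      (λ m → cls (line {p₁} {g₀ , m} g₁≢g₀))
      (λ m → trans (cong (λ J → pos J g₀) (sym (classBlock-unique refl (line-∈ˡ g₁≢g₀))))
                   (sym (∈⇒pos (line-∈ʳ g₁≢g₀))))
      (λ κ → trans (cong cls (sym (line-unique g₁≢g₀ (classBlock-∈ κ p₁) (pos-∈ _ g₀))))
                   (classBlock-cls κ p₁))
      where
      p₁ : Point
      p₁ = g₁ , m₁

Σ-weights↔ : ∀ v a b → Σ (Fin v ⊎ ⊤) (Fin ∘ [ const a , const b ]) ↔ Fin (v * a + b)
Σ-weights↔ v a b = ↔-trans Σ-distribʳ-⊎ (↔-trans (⊎-cong (↔-sym *↔×) ⊤×↔) (↔-sym +↔⊎))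
  where
  ⊤×↔ : (⊤ × Fin b) ↔ Fin b
  ⊤×↔ = mk↔ₛ′ proj₂ (tt ,_) (λ _ → refl) (λ _ → refl)

Fin-suc-split-↔ : ∀ {t u′} → t ≤ u′ → Fin (suc u′) ↔ (⊤ ⊎ (Fin t ⊎ Fin (u′ ∸ t)))
Fin-suc-split-↔ {t} {u′} t≤u′ =
  ↔-trans (+↔⊎ {1}) (⊎-cong 1↔⊤ (↔-trans (≡⇒Fin↔ (sym (m+[n∸m]≡n t≤u′))) +↔⊎))

weights-labelling : ∀ v a b → Labelling (replicate v a ++ b ∷ []) {Fin v ⊎ ⊤} [ const a , const b ]
weights-labelling v a b = ∷ʳ-labelling (replicate-labelling v a)

-- For c = 0 the group of size c is empty, and a design of type a^v b^1 serves.
sliceIngredient : ∀ {v a b c t u′} →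
  (0 < t * c → GDD 4 (replicate v a ++ b ∷ c ∷ [])) →
  (c ≡ 0 ⊎ t < u′ → GDD 4 (replicate v a ++ b ∷ [])) →
  Fin t → Design 4 {(Fin v ⊎ ⊤) ⊎ ⊤} [ [ const a , const b ] , const c ]
sliceIngredient {v} {a} {b} {zero} HY HC _ =
  withEmptyGroup (Labelled.design (HC (inj₁ refl)) (weights-labelling v a b))
sliceIngredient {v} {a} {b} {suc c} {suc t} HY HC _ =
  Labelled.design (HY (s≤s z≤n))
    (subst (λ L → Labelling L [ [ const a , const b ] , const (suc c) ])
      (++-assoc (replicate v a) (b ∷ []) (suc c ∷ []))
      (∷ʳ-labelling (weights-labelling v a b)))

sliceIngredient-finite : ∀ {v a b c t u′} HY HC i →
  Finite (GroupDesign.Block (sliceIngredient {v} {a} {b} {c} {t} {u′} HY HC i))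
sliceIngredient-finite {c = zero}          HY HC _ = _ , ↔-refl
sliceIngredient-finite {c = suc _} {suc _} HY HC _ = _ , ↔-refl

module _ {k L} {G : Set} {size : G → ℕ} (R : RGDD k L) (ℓ : Labelling L size) where

  rgddDesign : Design k size
  rgddDesign = Labelled.design (RGDD.gdd R) ℓ

  rgddResolution : Resolution rgddDesign
  rgddResolution = Labelled.transportedResolution (RGDD.gdd R) ℓ
    (record { r = RGDD.r R ; cls = RGDD.cls R ; parallel = RGDD.parallel R })

  rgddDesign-finite : Finite (GroupDesign.Block rgddDesign)
  rgddDesign-finite = _ , ↔-refl

module Construction (a b c d t u′ v′ : ℕ) (t≤u′ : t ≤ u′)
  (R  : RGDD (suc v′ + 1) (replicate (suc v′ + 1) (suc u′)))
  (HA : GDD 4 (replicate (suc u′) a ++ d ∷ []))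
  (HB : GDD 4 (replicate (suc u′) b ++ d ∷ []))
  (HY : 0 < t * c → GDD 4 (replicate (suc v′) a ++ b ∷ c ∷ []))
  (HC : c ≡ 0 ⊎ t < u′ → GDD 4 (replicate (suc v′) a ++ b ∷ [])) where

  u v : ℕ
  u = suc u′
  v = suc v′

  Group : Set
  Group = Fin v ⊎ ⊤

  weight : Group → ℕ
  weight = [ const a , const b ]

  TD-labelling : Labelling (replicate (v + 1) u) {Group} (const u)
  TD-labelling = relabel (replicate-labelling (v + 1) u) (Fin+1↔⊎⊤ v) (λ _ → refl)

  -- Opaque for the same reason as in ResolvableTD.
  opaque
    TD : Design (v + 1) {Group} (const u)
    TD = rgddDesign R TD-labelling

    TD-resolution : Resolution TD
    TD-resolution = rgddResolution R TD-labelling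

    TD-finite : Finite (GroupDesign.Block TD)
    TD-finite = rgddDesign-finite R TD-labelling

  open ResolvableTD (↔-sym (Fin+1↔⊎⊤ v)) TD TD-resolution
  open GroupDesign TD using (Block; _∈B_)
  open Resolution TD-resolution using (r; cls)

  g₀ : Group
  g₀ = inj₂ tt

  Label : Set
  Label = Fin t ⊎ Fin (u′ ∸ t)

  -- The class κ₀ supplies the new groups, the class labelled inj₁ i carries the i-th slice
  -- of points at infinity, and the remaining classes carry nothing.
  opaque
    classes : Fin r ↔ (⊤ ⊎ Label)
    classes = ↔-trans (classes↔ g₀ {inj₁ zero} (λ ()) zero) (Fin-suc-split-↔ t≤u′)

  κ₀ : Fin r
  κ₀ = from classes (inj₁ tt)

  label : Block → ⊤ ⊎ Label
  label j = to classes (cls j)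

  label≡⇒cls≡ : ∀ {j ℓ} → label j ≡ ℓ → cls j ≡ from classes ℓ
  label≡⇒cls≡ {j} e = trans (sym (strictlyInverseʳ classes (cls j))) (cong (from classes) e)

  label-classBlock : ∀ s p → label (classBlock (from classes (inj₂ s)) p) ≡ inj₂ s
  label-classBlock s p =
    trans (cong (to classes) (classBlock-cls (from classes (inj₂ s)) p)) (strictlyInverseˡ classes (inj₂ s))

  labelled-cls≢κ₀ : ∀ {j s} → label j ≡ inj₂ s → cls j ≢ κ₀
  labelled-cls≢κ₀ {j} e clsj≡κ₀
    with trans (sym e) (trans (cong (to classes) clsj≡κ₀) (strictlyInverseˡ classes (inj₁ tt)))
  ... | ()

  newGroup : Point → Fin u
  newGroup = blockIndex g₀ κ₀

  extra : Label → ℕ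
  extra (inj₁ _) = c
  extra (inj₂ _) = 0

  t<u′ : Fin (u′ ∸ t) → t < u′
  t<u′ m = m∸n≢0⇒n<m (≢-nonZero⁻¹ _ {{nonZeroIndex m}})

  blockIngredient : (s : Label) → Design 4 {Group ⊎ ⊤} [ weight , const (extra s) ]
  blockIngredient (inj₁ i) = sliceIngredient HY HC i
  blockIngredient (inj₂ m) = withEmptyGroup (Labelled.design (HC (inj₂ (t<u′ m))) (weights-labelling v a b))

  groupIngredient : (g : Group) → Design 4 {Fin u ⊎ ⊤} [ const (weight g) , const d ]
  groupIngredient (inj₁ _) = Labelled.design HA (∷ʳ-labelling (replicate-labelling u a))
  groupIngredient (inj₂ _) = Labelled.design HB (∷ʳ-labelling (replicate-labelling u b))

  Inflated : Set
  Inflated = Σ Point (Fin ∘ weight ∘ proj₁)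

  X : Set
  X = Inflated ⊎ ((Fin c × Fin t) ⊎ Fin d)

  γX : X → Fin u ⊎ ⊤
  γX (inj₁ (p , _)) = inj₁ (newGroup p)
  γX (inj₂ _)       = inj₂ tt

  LabelledBlock : Set
  LabelledBlock = Σ Block λ j → Σ Label λ s → label j ≡ inj₂ s

  Index : Set
  Index = LabelledBlock ⊎ Group

  LocalGroup : Index → Set
  LocalGroup (inj₁ _) = Group ⊎ ⊤
  LocalGroup (inj₂ _) = Fin u ⊎ ⊤

  localSize : (i : Index) → LocalGroup i → ℕ
  localSize (inj₁ (_ , s , _)) = [ weight , const (extra s) ]
  localSize (inj₂ g)           = [ const (weight g) , const d ]

  Local : Index → Set
  Local i = Σ (LocalGroup i) (Fin ∘ localSize i)

  local : (i : Index) → Design 4 (localSize i)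
  local (inj₁ (_ , s , _)) = blockIngredient s
  local (inj₂ g)           = groupIngredient g

  embed : (i : Index) → Local i → X
  embed (inj₁ (j , s , _)) (inj₁ g , w)  = inj₁ ((g , pos j g) , w)
  embed (inj₁ (j , inj₁ i , _)) (inj₂ tt , z) = inj₂ (inj₁ (z , i))
  embed (inj₁ (j , inj₂ _ , _)) (inj₂ tt , ())
  embed (inj₂ g) (inj₁ m , w)  = inj₁ ((g , m) , w)
  embed (inj₂ g) (inj₂ tt , z) = inj₂ (inj₂ z)

  embed-injective : ∀ i → Injective _≡_ _≡_ (embed i)
  embed-injective (inj₁ (j , s , _))     {inj₁ g , w}  {inj₁ _ , _}  refl = refl
  embed-injective (inj₁ (j , inj₁ i , _)) {inj₂ tt , z} {inj₂ tt , _} refl = refl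
  embed-injective (inj₁ (j , inj₁ i , _)) {inj₁ _ , _}  {inj₂ tt , _} ()
  embed-injective (inj₁ (j , inj₁ i , _)) {inj₂ tt , _} {inj₁ _ , _}  ()
  embed-injective (inj₁ (j , inj₂ _ , _)) {inj₂ tt , ()}
  embed-injective (inj₁ (j , inj₂ _ , _)) {inj₁ _ , _} {inj₂ tt , ()}
  embed-injective (inj₂ g) {inj₁ _ , _}  {inj₁ _ , _}  refl = refl
  embed-injective (inj₂ g) {inj₂ tt , _} {inj₂ tt , _} refl = refl
  embed-injective (inj₂ g) {inj₁ _ , _}  {inj₂ tt , _} ()
  embed-injective (inj₂ g) {inj₂ tt , _} {inj₁ _ , _}  ()

  embed-separates : ∀ i x y → proj₁ x ≢ proj₁ y → γX (embed i x) ≢ γX (embed i y)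
  embed-separates (inj₁ (j , s , e)) (inj₁ g , _) (inj₁ g′ , _) g≢g′ γ≡ =
    blockIndex-separates g₀ (labelled-cls≢κ₀ e) (pos-∈ j g) (pos-∈ j g′) (λ g≡g′ → g≢g′ (cong inj₁ g≡g′))
      (inj₁-injective γ≡)
  embed-separates (inj₁ (j , inj₁ i , _)) (inj₁ _ , _)  (inj₂ tt , _) _ ()
  embed-separates (inj₁ (j , inj₁ i , _)) (inj₂ tt , _) (inj₁ _ , _)  _ ()
  embed-separates (inj₁ (j , inj₁ i , _)) (inj₂ tt , _) (inj₂ tt , _) ne = ⊥-elim (ne refl)
  embed-separates (inj₁ (j , inj₂ _ , _)) (inj₁ _ , _)  (inj₂ tt , ()) _
  embed-separates (inj₁ (j , inj₂ _ , _)) (inj₂ tt , ()) _ _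
  embed-separates (inj₂ g) (inj₁ m , _) (inj₁ m′ , _) m≢m′ γ≡ =
    m≢m′ (cong inj₁ (blockIndex-injective-on-group g₀ (inj₁-injective γ≡)))
  embed-separates (inj₂ g) (inj₁ _ , _)  (inj₂ tt , _) _ ()
  embed-separates (inj₂ g) (inj₂ tt , _) (inj₁ _ , _)  _ ()
  embed-separates (inj₂ g) (inj₂ tt , _) (inj₂ tt , _) ne = ⊥-elim (ne refl)

  embed-inflated : ∀ {j s e x′ g m w} → embed (inj₁ (j , s , e)) x′ ≡ inj₁ ((g , m) , w) → (g , m) ∈B j
  embed-inflated {j} {x′ = inj₁ g , _} refl = pos-∈ j g
  embed-inflated {s = inj₁ _} {x′ = inj₂ tt , _} ()

  embed-slice : ∀ {j s e x′ z i} → embed (inj₁ (j , s , e)) x′ ≡ inj₂ (inj₁ (z , i)) → s ≡ inj₁ i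
  embed-slice {s = inj₁ _} {x′ = inj₂ tt , _} refl = refl
  embed-slice {x′ = inj₁ _ , _} ()

  embed-≢-fixed : ∀ {j s e x′ z} → embed (inj₁ (j , s , e)) x′ ≢ inj₂ (inj₂ z)
  embed-≢-fixed {s = inj₁ _} {x′ = inj₂ tt , _} ()
  embed-≢-fixed {x′ = inj₁ _ , _} ()

  embed-group : ∀ {g x′ g′ m w} → embed (inj₂ g) x′ ≡ inj₁ ((g′ , m) , w) → g′ ≡ g
  embed-group {x′ = inj₁ _ , _} refl = refl

  embed-≢-slice : ∀ {g x′ z i} → embed (inj₂ g) x′ ≢ inj₂ (inj₁ (z , i))
  embed-≢-slice {x′ = inj₁ _ , _} ()
  embed-≢-slice {x′ = inj₂ tt , _} ()

  labelledBlock-≡ : ∀ {j j′ s s′} (e : label j ≡ inj₂ s) (e′ : label j′ ≡ inj₂ s′) → j′ ≡ j →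
                _≡_ {A = LabelledBlock} (j′ , s′ , e′) (j , s , e)
  labelledBlock-≡ e e′ refl with inj₂-injective (trans (sym e′) e)
  ... | refl = cong (λ e → _ , _ , e) (uip _ _)

  open Glue γX (λ _ → proj₁) local embed embed-injective embed-separates
    using (Covering; covering; Covering-sym; glued)

  module _ (g : Group) (m : Fin u) (w : Fin (weight g)) where

    coverSameGroup : ∀ m′ w′ → γX (inj₁ ((g , m) , w)) ≢ γX (inj₁ ((g , m′) , w′)) →
                     Covering (inj₁ ((g , m) , w)) (inj₁ ((g , m′) , w′))
    coverSameGroup m′ w′ γ≢ = covering (inj₂ g) (inj₁ m , w) (inj₁ m′ , w′) refl refl
      (γ≢ ∘ cong (inj₁ ∘ newGroup ∘ (g ,_)) ∘ inj₁-injective) unique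
      where
      unique : ∀ i x″ y″ → embed i x″ ≡ inj₁ ((g , m) , w) → embed i y″ ≡ inj₁ ((g , m′) , w′) →
               i ≡ inj₂ g
      unique (inj₁ _) _ _ x↦ y↦ = ⊥-elim (γ≢ (cong (inj₁ ∘ newGroup ∘ (g ,_))
        (trans (∈⇒pos (embed-inflated x↦)) (sym (∈⇒pos (embed-inflated y↦))))))
      unique (inj₂ _) _ _ x↦ _  = cong inj₂ (sym (embed-group x↦))

    coverAcross : ∀ {g′} m′ w′ (apart : g ≢ g′) →
                  γX (inj₁ ((g , m) , w)) ≢ γX (inj₁ ((g′ , m′) , w′)) →
                  Covering (inj₁ ((g , m) , w)) (inj₁ ((g′ , m′) , w′))
    coverAcross {g′} m′ w′ apart γ≢ = byLabel (label L) refl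
      where
      L : Block
      L = line {g , m} {g′ , m′} apart
      byLabel : ∀ ℓ → label L ≡ ℓ → Covering (inj₁ ((g , m) , w)) (inj₁ ((g′ , m′) , w′))
      byLabel (inj₁ tt) e = ⊥-elim (γ≢ (cong inj₁
        (∈-class⇒blockIndex-≡ g₀ (label≡⇒cls≡ e) (line-∈ˡ apart) (line-∈ʳ apart))))
      byLabel (inj₂ s) e = covering (inj₁ (L , s , e)) (inj₁ g , w) (inj₁ g′ , w′)
        (cong (λ m → inj₁ ((g , m) , w)) (sym (∈⇒pos (line-∈ˡ apart))))
        (cong (λ m → inj₁ ((g′ , m) , w′)) (sym (∈⇒pos (line-∈ʳ apart))))
        (λ g≡g′ → apart (inj₁-injective g≡g′)) unique
        where
        unique : ∀ i x″ y″ → embed i x″ ≡ inj₁ ((g , m) , w) → embed i y″ ≡ inj₁ ((g′ , m′) , w′) →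
                 i ≡ inj₁ (L , s , e)
        unique (inj₁ (_ , _ , e′)) _ _ x↦ y↦ =
          cong inj₁ (labelledBlock-≡ e e′ (line-unique apart (embed-inflated x↦) (embed-inflated y↦)))
        unique (inj₂ _) _ _ x↦ y↦ = ⊥-elim (apart (trans (embed-group x↦) (sym (embed-group y↦))))

    coverSlice : ∀ z i → Covering (inj₁ ((g , m) , w)) (inj₂ (inj₁ (z , i)))
    coverSlice z i = covering (inj₁ (J , inj₁ i , J-label)) (inj₁ g , w) (inj₂ tt , z)
      (cong (λ m → inj₁ ((g , m) , w)) (sym (∈⇒pos (classBlock-∈ _ (g , m))))) refl (λ ()) unique
      where
      J : Block
      J = classBlock (from classes (inj₂ (inj₁ i))) (g , m)
      J-label : label J ≡ inj₂ (inj₁ i)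
      J-label = label-classBlock (inj₁ i) (g , m)
      unique : ∀ i′ x″ y″ → embed i′ x″ ≡ inj₁ ((g , m) , w) → embed i′ y″ ≡ inj₂ (inj₁ (z , i)) →
               i′ ≡ inj₁ (J , inj₁ i , J-label)
      unique (inj₁ (_ , _ , e′)) _ _ x↦ y↦ = cong inj₁ (labelledBlock-≡ J-label e′
        (classBlock-unique (label≡⇒cls≡ (trans e′ (cong inj₂ (embed-slice y↦)))) (embed-inflated x↦)))
      unique (inj₂ _) _ _ _ y↦ = ⊥-elim (embed-≢-slice y↦)

    coverFixed : ∀ z → Covering (inj₁ ((g , m) , w)) (inj₂ (inj₂ z))
    coverFixed z = covering (inj₂ g) (inj₁ m , w) (inj₂ tt , z) refl refl (λ ()) unique
      where
      unique : ∀ i x″ y″ → embed i x″ ≡ inj₁ ((g , m) , w) → embed i y″ ≡ inj₂ (inj₂ z) → i ≡ inj₂ g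
      unique (inj₁ _) _ _ _  y↦ = ⊥-elim (embed-≢-fixed y↦)
      unique (inj₂ _) _ _ x↦ _  = cong inj₂ (sym (embed-group x↦))

  covered : ∀ x y → γX x ≢ γX y → Covering x y
  covered (inj₁ ((g , m) , w)) (inj₁ ((g′ , m′) , w′)) γ≢ with ≡-dec _≟_ Data.Unit.Properties._≟_ g g′
  ... | yes refl  = coverSameGroup g m w m′ w′ γ≢
  ... | no  apart = coverAcross g m w m′ w′ apart γ≢
  covered (inj₁ ((g , m) , w)) (inj₂ (inj₁ (z , i))) _ = coverSlice g m w z i
  covered (inj₁ ((g , m) , w)) (inj₂ (inj₂ z))       _ = coverFixed g m w z
  covered (inj₂ (inj₁ (z , i))) (inj₁ ((g , m) , w)) _ = Covering-sym (coverSlice g m w z i)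
  covered (inj₂ (inj₂ z))       (inj₁ ((g , m) , w)) _ = Covering-sym (coverFixed g m w z)
  covered (inj₂ _) (inj₂ _) γ≢ = ⊥-elim (γ≢ refl)

  fibre-newGroup↔ : ∀ m → Fibre γX (inj₁ m) ↔ Σ Group (Fin ∘ weight)
  fibre-newGroup↔ m = mk↔ₛ′ forget place (λ _ → refl) place-forget
    where
    J : Block
    J = indexedBlock g₀ κ₀ m
    forget : Fibre γX (inj₁ m) → Σ Group (Fin ∘ weight)
    forget (inj₁ ((g , _) , w) , _) = g , w
    place : Σ Group (Fin ∘ weight) → Fibre γX (inj₁ m)
    place (g , w) = inj₁ ((g , pos J g) , w) , cong inj₁ (blockIndex-pos g₀ κ₀ m g)
    place-forget : ∀ x → place (forget x) ≡ x
    place-forget (inj₁ ((g , m′) , w) , e) with blockIndex-≡⇒pos g₀ (inj₁-injective e)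
    ... | refl = cong (inj₁ ((g , pos J g) , w) ,_) (uip _ e)

  fibre-∞↔ : Fibre γX (inj₂ tt) ↔ ((Fin c × Fin t) ⊎ Fin d)
  fibre-∞↔ = mk↔ₛ′ forget (λ y → inj₂ y , refl) (λ _ → refl) place-forget
    where
    forget : Fibre γX (inj₂ tt) → (Fin c × Fin t) ⊎ Fin d
    forget (inj₂ y , _) = y
    place-forget : ∀ x → (inj₂ (forget x) , refl) ≡ x
    place-forget (inj₂ _ , refl) = refl

  fibre↔ : ∀ y → Fibre γX y ↔ Fin ([ const (v * a + b) , const (c * t + d) ] y)
  fibre↔ (inj₁ m)  = ↔-trans (fibre-newGroup↔ m) (Σ-weights↔ v a b)
  fibre↔ (inj₂ tt) = ↔-trans fibre-∞↔ (↔-trans (⊎-cong (↔-sym *↔×) ↔-refl) (↔-sym +↔⊎))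

  labelled-finite : (ℓ : ⊤ ⊎ Label) → Finite (Σ Label λ s → ℓ ≡ inj₂ s)
  labelled-finite (inj₁ tt) = 0 , mk↔ₛ′ (λ { (_ , ()) }) (λ ()) (λ ()) (λ { (_ , ()) })
  labelled-finite (inj₂ s)  =
    1 , mk↔ₛ′ (const zero) (λ _ → s , refl) (λ { zero → refl }) (λ { (_ , refl) → refl })

  local-finite : ∀ i → Finite (GroupDesign.Block (local i))
  local-finite (inj₁ (_ , inj₁ i , _)) = sliceIngredient-finite HY HC i
  local-finite (inj₁ (_ , inj₂ _ , _)) = _ , ↔-refl
  local-finite (inj₂ (inj₁ _))         = _ , ↔-refl
  local-finite (inj₂ (inj₂ _))         = _ , ↔-refl

  gdd : GDD 4 (replicate u (v * a + b) ++ (c * t + d) ∷ [])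
  gdd = design⇒GDD (glued covered) (∷ʳ-labelling (replicate-labelling u (v * a + b))) fibre↔
    (Σ-finite (⊎-finite (Σ-finite TD-finite (labelled-finite ∘ label)) (v + 1 , ↔-sym (Fin+1↔⊎⊤ v)))
              local-finite)
    (inj₂ g₀ , fromℕ< (GDD.nonEmpty HB))

theorem3p3 : (a b c d t u v : ℕ) →
    2 ≤ v → v ≤ u ∸ 1 → t ≤ u ∸ 1 →
    RGDD (v + 1) (replicate (v + 1) u) →
    GDD 4 (replicate u a ++ d ∷ []) →
    GDD 4 (replicate u b ++ d ∷ []) →
    (0 < t * c → GDD 4 (replicate v a ++ b ∷ c ∷ [])) →
    (c ≡ 0 ⊎ t < u ∸ 1 → GDD 4 (replicate v a ++ b ∷ [])) →
    GDD 4 (replicate u (v * a + b) ++ (c * t + d) ∷ [])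
theorem3p3 a b c d t zero    (suc v′) (s≤s _) () _ _ _ _ _ _
theorem3p3 a b c d t (suc u′) (suc v′) _ _ t≤u′ R HA HB HY HC =
  Construction.gdd a b c d t u′ v′ t≤u′ R HA HB HY HC
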